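{- Let $\boldsymbol{\alpha}=(\alpha_i)_{i\in\mathbb{Z}}$ be commuting indeterminates. If $k,\ell$ are integers with $0 < k \leqslant \ell$, then \[ \sum_{\substack{1 \leqslant j \leqslant \ell \\ j - \ell \leqslant i \leqslant \min (0, j - k)}} h_{i - j + \ell}(\alpha_i,\alpha_{i+1},\dots,\alpha_j) \, e_{j - i - k} (-\alpha_{i+1},-\alpha_{i+2},\dots,-\alpha_{j-1}) = k\, \delta_{k\ell}. \]
   Context: $e_r$ and $h_r$ denote the elementary and complete homogeneous symmetric polynomials in the listed variables, with $e_0=h_0=1$, $e_r=h_r=0$ for $r<0$, and $e_r$ (resp. $h_r$) of an empty list of variables equal to $0$ for $r>0$. The sum runs over pairs of integers $(i,j)$ satisfying the indicated inequalities. $\delta$ is the Kronecker delta. -}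

module Defs where

open import Level using (Level)
open import Algebra.Bundles using (CommutativeRing)
open import Data.Nat as ℕ using (ℕ; zero; suc)
open import Data.Integer as ℤ using (ℤ; +_; -[1+_])
open import Data.List using (List; []; _∷_; map; foldr)
open import Data.Bool using (if_then_else_)
open import Relation.Nullary.Decidable using (⌊_⌋)

count : ℤ → ℕ
count (+ n) = n
count -[1+ n ] = 0

fromLen : ℤ → ℕ → List ℤ
fromLen a zero = []
fromLen a (suc n) = a ∷ fromLen (a ℤ.+ ℤ.1ℤ) n

interval : ℤ → ℤ → List ℤ
interval a b = fromLen a (count ((b ℤ.- a) ℤ.+ ℤ.1ℤ))

module _ {c ℓ : Level} (R : CommutativeRing c ℓ) where
  open CommutativeRing R

  Σ : List Carrier → Carrier
  Σ = foldr _+_ 0#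

  natR : ℕ → Carrier
  natR zero = 0#
  natR (suc n) = 1# + natR n

  eₙ : ℕ → List Carrier → Carrier
  eₙ zero xs = 1#
  eₙ (suc r) [] = 0#
  eₙ (suc r) (x ∷ xs) = eₙ (suc r) xs + x * eₙ r xs

  hₙ : ℕ → List Carrier → Carrier
  hₙ zero xs = 1#
  hₙ (suc r) [] = 0#
  hₙ (suc r) (x ∷ xs) = hₙ (suc r) xs + x * hₙ r (x ∷ xs)

  e : ℤ → List Carrier → Carrier
  e (+ n) xs = eₙ n xs
  e -[1+ n ] xs = 0#

  h : ℤ → List Carrier → Carrier
  h (+ n) xs = hₙ n xs
  h -[1+ n ] xs = 0#

  vars : (ℤ → Carrier) → ℤ → ℤ → List Carrier
  vars α a b = map α (interval a b)

  negVars : (ℤ → Carrier) → ℤ → ℤ → List Carrier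
  negVars α a b = map (λ t → - α t) (interval a b)

  δ : ℤ → ℤ → Carrier
  δ k l = if ⌊ k ℤ.≟ l ⌋ then 1# else 0#

{-# OPTIONS --safe #-}
module Submission where

open import Defs
open import Algebra.Bundles using (CommutativeRing)
open import Data.Integer using (ℤ; _+_; _-_; _≤_; _<_; _⊓_; 0ℤ; 1ℤ; ∣_∣)
open import Data.List using (map)

open import Data.Nat as ℕ using (zero; suc; s≤s; z≤n)
open import Data.Integer using (+_; -[1+_]; -_; +≤+; +<+; -<+)
import Data.Integer.Properties as ℤP
import Data.Nat.Properties as ℕP
open import Data.Integer.Tactic.RingSolver using (solve-∀)
open import Data.List using ([]; _∷_; _++_; _∷ʳ_; length)
open import Data.List.Properties using (map-++; length-map)
open import Data.List.Relation.Unary.All using (All; []; _∷_)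
open import Data.Product using (∃-syntax; _,_)
open import Data.Empty using (⊥-elim)
open import Function using (_∘_)
open import Relation.Nullary using (Dec; yes; no)
open import Relation.Binary.PropositionalEquality
  using (_≡_; _≢_; refl; sym; trans; cong; cong₂; subst; subst₂; module ≡-Reasoning)

-- Replacing the inner upper limit min(0, j-k) by 0 only adds terms with
-- e_{<0} = 0; call the resulting double sum S(k,l).  The recurrences of h and e
-- in their first variable make each summand a telescoping difference,
--   F(k,l,i,j) + G(i) = F(k-1,l-1,i,j) + G(i+1),
--   G(i) = e_{j-i-k+1}(-α_i,..,-α_{j-1}) h_{i-j+l-1}(α_i,..,α_j),
-- so summing over i gives S(k,l) = S(k-1,l-1) + B(k,l), where
--   B(k,l) = Σ_{1≤j≤l} h_{l-j}(α_1,..,α_j) e_{j-k}(-α_1,..,-α_{j-1}).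
-- The recurrences in the last variable telescope B(k,l) in the same way:
-- B(k,l) = B(k-1,l-1) + e_{1-k}() h_{l-1}(), and the corner term is δ_{k1} δ_{l1}.
-- Since e_r vanishes on fewer than r variables, S(0,l) = B(0,l) = 0; hence
-- B(k,l) = δ_{kl} for k ≥ 1 and S(k,l) = Σ_{m=1}^{k} B(m, l-k+m) = k δ_{kl}.

i≤j⇒∃[n]j≡i+n : ∀ {i j} → i ≤ j → ∃[ n ] j ≡ i + + n
i≤j⇒∃[n]j≡i+n {i} {j} i≤j = ∣ j - i ∣ , (begin
  j                ≡⟨ j≡i+[j-i] i j ⟩
  i + (j - i)      ≡⟨ cong (_+_ i) (sym (ℤP.0≤i⇒+∣i∣≡i (ℤP.i≤j⇒0≤j-i i≤j))) ⟩
  i + + ∣ j - i ∣  ∎)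
  where
  open ≡-Reasoning
  j≡i+[j-i] : ∀ i j → j ≡ i + (j - i)
  j≡i+[j-i] = solve-∀

fromLen-++ : ∀ a m n → fromLen a (m ℕ.+ n) ≡ fromLen a m ++ fromLen (a + + m) n
fromLen-++ a zero    n = cong (λ b → fromLen b n) (sym (ℤP.+-identityʳ a))
fromLen-++ a (suc m) n = cong (a ∷_) (trans (fromLen-++ (a + 1ℤ) m n)
  (cong (λ b → fromLen (a + 1ℤ) m ++ fromLen b n) (ℤP.+-assoc a 1ℤ (+ m))))

length-fromLen : ∀ a n → length (fromLen a n) ≡ n
length-fromLen a zero    = refl
length-fromLen a (suc n) = cong suc (length-fromLen (a + 1ℤ) n)

All-fromLen : ∀ {p} {P : ℤ → Set p} a n → (∀ {i} → a ≤ i → i < a + + n → P i) →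
              All P (fromLen a n)
All-fromLen a zero    _         = []
All-fromLen a (suc n) P-bounded =
  P-bounded ℤP.≤-refl (subst (_< a + + suc n) (ℤP.+-identityʳ a) (ℤP.+-monoʳ-< a (+<+ (s≤s z≤n))))
  ∷ All-fromLen (a + 1ℤ) n (λ a+1≤i i<a+1+n →
      P-bounded (ℤP.≤-trans (ℤP.i≤i+j a 1ℤ) a+1≤i) (subst (_ <_) (ℤP.+-assoc a 1ℤ (+ n)) i<a+1+n))

All-interval : ∀ {p} {P : ℤ → Set p} {a b} → (∀ {i} → a ≤ i → i ≤ b → P i) →
               All P (interval a b)
All-interval {a = a} {b} P-bounded with (b - a) + 1ℤ in eq
... | -[1+ _ ] = []
... | + n      = All-fromLen a n (λ a≤i i<a+n → P-bounded a≤i (i<a+n⇒i≤b i<a+n))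
  where
  a+[[b-a]+1]≡1+b : ∀ a b → a + ((b - a) + 1ℤ) ≡ 1ℤ + b
  a+[[b-a]+1]≡1+b = solve-∀
  i<a+n⇒i≤b : ∀ {i} → i < a + + n → i ≤ b
  i<a+n⇒i≤b i<a+n = subst (_ ≤_) (ℤP.pred-suc b) (ℤP.i<j⇒i≤pred[j]
    (subst (_ <_) (trans (cong (_+_ a) (sym eq)) (a+[[b-a]+1]≡1+b a b)) i<a+n))

interval-fromLen : ∀ {a} b {n} → b + 1ℤ ≡ a + + n → interval a b ≡ fromLen a n
interval-fromLen {a} b {n} b+1≡a+n = cong (fromLen a ∘ count) (begin
  (b - a) + 1ℤ  ≡⟨ [b-a]+1≡[b+1]-a a b ⟩
  (b + 1ℤ) - a  ≡⟨ cong (_- a) b+1≡a+n ⟩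
  (a + + n) - a ≡⟨ [a+n]-a≡n a (+ n) ⟩
  + n           ∎)
  where
  open ≡-Reasoning
  [b-a]+1≡[b+1]-a : ∀ a b → (b - a) + 1ℤ ≡ (b + 1ℤ) - a
  [b-a]+1≡[b+1]-a = solve-∀
  [a+n]-a≡n : ∀ a n → (a + n) - a ≡ n
  [a+n]-a≡n = solve-∀

interval-empty : ∀ {a} b → b + 1ℤ ≡ a → interval a b ≡ []
interval-empty {a} b b+1≡a = interval-fromLen b (trans b+1≡a (sym (ℤP.+-identityʳ a)))

private
  [a+1]-1≡a : ∀ a → (a + 1ℤ) - 1ℤ ≡ a
  [a+1]-1≡a = solve-∀
  [[i-j]+l]-1≡[i-j]+[l-1] : ∀ i j l → ((i - j) + l) - 1ℤ ≡ (i - j) + (l - 1ℤ)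
  [[i-j]+l]-1≡[i-j]+[l-1] = solve-∀
  i≤0⇒i+1≤j : ∀ {i j} → i ≤ 0ℤ → 1ℤ ≤ j → i + 1ℤ ≤ j
  i≤0⇒i+1≤j i≤0 1≤j = ℤP.≤-trans (ℤP.+-monoˡ-≤ 1ℤ i≤0) 1≤j
  [a+n]+1≡a+[1+n] : ∀ a n → (a + n) + 1ℤ ≡ a + (1ℤ + n)
  [a+n]+1≡a+[1+n] = solve-∀
  [a+n]+1≡[a+1]+n : ∀ a n → (a + n) + 1ℤ ≡ (a + 1ℤ) + n
  [a+n]+1≡[a+1]+n = solve-∀
  [[a+n]-1]+1≡a+n : ∀ a n → ((a + n) - 1ℤ) + 1ℤ ≡ a + n
  [[a+n]-1]+1≡a+n = solve-∀

interval-∷ : ∀ {a b} → a ≤ b → interval a b ≡ a ∷ interval (a + 1ℤ) b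
interval-∷ {a} a≤b with i≤j⇒∃[n]j≡i+n a≤b
... | n , refl = trans (interval-fromLen (a + + n) ([a+n]+1≡a+[1+n] a (+ n)))
                       (cong (a ∷_) (sym (interval-fromLen (a + + n) ([a+n]+1≡[a+1]+n a (+ n)))))

interval-∷ʳ : ∀ {a b} → a ≤ b → interval a b ≡ interval a (b - 1ℤ) ∷ʳ b
interval-∷ʳ {a} a≤b with i≤j⇒∃[n]j≡i+n a≤b
... | n , refl = begin
  interval a (a + + n)               ≡⟨ interval-fromLen (a + + n) (ℤP.+-assoc a (+ n) 1ℤ) ⟩
  fromLen a (n ℕ.+ 1)                ≡⟨ fromLen-++ a n 1 ⟩
  fromLen a n ∷ʳ (a + + n)           ≡⟨ cong (_∷ʳ (a + + n)) (sym (interval-fromLen ((a + + n) - 1ℤ) ([[a+n]-1]+1≡a+n a (+ n)))) ⟩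
  interval a ((a + + n) - 1ℤ) ∷ʳ (a + + n) ∎
  where open ≡-Reasoning

interval-++ : ∀ {a m b} → a ≤ m + 1ℤ → m ≤ b → interval a b ≡ interval a m ++ interval (m + 1ℤ) b
interval-++ {a} {m} a≤m+1 m≤b with i≤j⇒∃[n]j≡i+n a≤m+1 | i≤j⇒∃[n]j≡i+n m≤b
... | p , m+1≡a+p | q , refl = begin
  interval a (m + + q)                          ≡⟨ interval-fromLen (m + + q) b+1≡a+[p+q] ⟩
  fromLen a (p ℕ.+ q)                           ≡⟨ fromLen-++ a p q ⟩
  fromLen a p ++ fromLen (a + + p) q            ≡⟨ cong₂ _++_ (sym (interval-fromLen m m+1≡a+p))
                                                          (cong (λ c → fromLen c q) (sym m+1≡a+p)) ⟩
  interval a m ++ fromLen (m + 1ℤ) q            ≡⟨ cong (interval a m ++_) (sym (interval-fromLen (m + + q) ([a+n]+1≡[a+1]+n m (+ q)))) ⟩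
  interval a m ++ interval (m + 1ℤ) (m + + q)   ∎
  where
  open ≡-Reasoning
  b+1≡a+[p+q] : (m + + q) + 1ℤ ≡ a + + (p ℕ.+ q)
  b+1≡a+[p+q] = begin
    (m + + q) + 1ℤ   ≡⟨ [a+n]+1≡[a+1]+n m (+ q) ⟩
    (m + 1ℤ) + + q   ≡⟨ cong (_+ + q) m+1≡a+p ⟩
    (a + + p) + + q  ≡⟨ ℤP.+-assoc a (+ p) (+ q) ⟩
    a + + (p ℕ.+ q)  ∎

module _ {c ℓ} (R : CommutativeRing c ℓ) where
  open CommutativeRing R
    using (Carrier; _≈_; 0#; 1#; setoid; +-cong; +-congˡ; +-congʳ; *-congˡ; *-congʳ;
           +-identityˡ; +-identityʳ; *-identityʳ; zeroˡ; zeroʳ; +-assoc; *-comm;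
           -‿inverseˡ; ring; commutativeSemiring; +-commutativeSemigroup)
    renaming (_+_ to infixl 6 _⊕_; _*_ to infixl 7 _⊛_; -_ to infix 8 ⊝_;
              refl to ≈-refl; sym to ≈-sym; trans to ≈-trans; reflexive to ≈-reflexive)
  open import Relation.Binary.Reasoning.Setoid setoid
  open import Algebra.Properties.Ring ring using (-‿distribˡ-*)
  open import Algebra.Properties.CommutativeSemigroup +-commutativeSemigroup
    using (interchange; xy∙z≈xz∙y; xy∙z≈x∙zy)
  open import Algebra.Solver.Ring.NaturalCoefficients.Default commutativeSemiring
    using (solve; _:=_; _:+_; _:*_; con)

  h-∷ : ∀ r x xs → h R r (x ∷ xs) ≈ h R r xs ⊕ x ⊛ h R (r - 1ℤ) (x ∷ xs)
  h-∷ (+ zero)  x xs = ≈-sym (≈-trans (+-congˡ (zeroʳ x)) (+-identityʳ 1#))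
  h-∷ (+ suc n) x xs = ≈-refl
  h-∷ -[1+ n ]  x xs = ≈-sym (≈-trans (+-congˡ (zeroʳ x)) (+-identityʳ 0#))

  e-∷ : ∀ r x xs → e R r (x ∷ xs) ≈ e R r xs ⊕ x ⊛ e R (r - 1ℤ) xs
  e-∷ (+ zero)  x xs = ≈-sym (≈-trans (+-congˡ (zeroʳ x)) (+-identityʳ 1#))
  e-∷ (+ suc n) x xs = ≈-refl
  e-∷ -[1+ n ]  x xs = ≈-sym (≈-trans (+-congˡ (zeroʳ x)) (+-identityʳ 0#))

  e-∷ʳ : ∀ r xs y → e R r (xs ∷ʳ y) ≈ e R r xs ⊕ y ⊛ e R (r - 1ℤ) xs
  e-∷ʳ r []       y = e-∷ r y []
  e-∷ʳ r (x ∷ xs) y = begin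
    e R r (x ∷ xs ∷ʳ y)                             ≈⟨ e-∷ r x (xs ∷ʳ y) ⟩
    e R r (xs ∷ʳ y) ⊕ x ⊛ e R (r - 1ℤ) (xs ∷ʳ y)   ≈⟨ +-cong (e-∷ʳ r xs y) (*-congˡ (e-∷ʳ (r - 1ℤ) xs y)) ⟩
    (A ⊕ y ⊛ B) ⊕ x ⊛ (B ⊕ y ⊛ C)                  ≈⟨ swap-last-two A B C x y ⟩
    (A ⊕ x ⊛ B) ⊕ y ⊛ (B ⊕ x ⊛ C)                  ≈⟨ ≈-sym (+-cong (e-∷ r x xs) (*-congˡ (e-∷ (r - 1ℤ) x xs))) ⟩
    e R r (x ∷ xs) ⊕ y ⊛ e R (r - 1ℤ) (x ∷ xs)     ∎
    where
    A = e R r xs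
    B = e R (r - 1ℤ) xs
    C = e R ((r - 1ℤ) - 1ℤ) xs
    swap-last-two : ∀ A B C x y → (A ⊕ y ⊛ B) ⊕ x ⊛ (B ⊕ y ⊛ C) ≈ (A ⊕ x ⊛ B) ⊕ y ⊛ (B ⊕ x ⊛ C)
    swap-last-two = solve 5 (λ A B C x y → (A :+ y :* B) :+ x :* (B :+ y :* C) := (A :+ x :* B) :+ y :* (B :+ x :* C)) ≈-refl

  h-∷ʳ : ∀ r xs y → h R r (xs ∷ʳ y) ≈ h R r xs ⊕ y ⊛ h R (r - 1ℤ) (xs ∷ʳ y)
  h-∷ʳ r        []       y = h-∷ r y []
  h-∷ʳ -[1+ n ] (x ∷ xs) y = ≈-sym (≈-trans (+-congˡ (zeroʳ y)) (+-identityʳ 0#))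
  h-∷ʳ (+ n)    (x ∷ xs) y = go n
    where
    go : ∀ n → h R (+ n) (x ∷ xs ∷ʳ y) ≈ h R (+ n) (x ∷ xs) ⊕ y ⊛ h R (+ n - 1ℤ) (x ∷ xs ∷ʳ y)
    go zero    = ≈-sym (≈-trans (+-congˡ (zeroʳ y)) (+-identityʳ 1#))
    go (suc n) = begin
      h R (+ suc n) (xs ∷ʳ y) ⊕ x ⊛ h R (+ n) (x ∷ xs ∷ʳ y)  ≈⟨ +-cong (h-∷ʳ (+ suc n) xs y) (*-congˡ (go n)) ⟩
      (A ⊕ y ⊛ B) ⊕ x ⊛ (C ⊕ y ⊛ D)                          ≈⟨ swap-last-two A B C D x y ⟩
      (A ⊕ x ⊛ C) ⊕ y ⊛ (B ⊕ x ⊛ D)                          ≈⟨ +-congˡ (*-congˡ (≈-sym (h-∷ (+ n) x (xs ∷ʳ y)))) ⟩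
      h R (+ suc n) (x ∷ xs) ⊕ y ⊛ h R (+ n) (x ∷ xs ∷ʳ y)   ∎
      where
      A = h R (+ suc n) xs
      B = h R (+ n) (xs ∷ʳ y)
      C = h R (+ n) (x ∷ xs)
      D = h R (+ n - 1ℤ) (x ∷ xs ∷ʳ y)
      swap-last-two : ∀ A B C D x y → (A ⊕ y ⊛ B) ⊕ x ⊛ (C ⊕ y ⊛ D) ≈ (A ⊕ x ⊛ C) ⊕ y ⊛ (B ⊕ x ⊛ D)
      swap-last-two = solve 6 (λ A B C D x y → (A :+ y :* B) :+ x :* (C :+ y :* D) := (A :+ x :* C) :+ y :* (B :+ x :* D)) ≈-refl

  h-negative : ∀ {r} xs → r < 0ℤ → h R r xs ≈ 0#
  h-negative { -[1+ _ ]} xs _         = ≈-refl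
  h-negative {+ _}       xs (+<+ ())

  e-negative : ∀ {r} xs → r < 0ℤ → e R r xs ≈ 0#
  e-negative { -[1+ _ ]} xs _         = ≈-refl
  e-negative {+ _}       xs (+<+ ())

  eₙ-vanishes : ∀ {r} xs → length xs ℕ.< r → eₙ R r xs ≈ 0#
  eₙ-vanishes {suc r} []       _               = ≈-refl
  eₙ-vanishes {suc r} (x ∷ xs) (s≤s |xs|<r) =
    ≈-trans (+-cong (eₙ-vanishes xs (ℕP.m≤n⇒m≤1+n |xs|<r)) (≈-trans (*-congˡ (eₙ-vanishes xs |xs|<r)) (zeroʳ x)))
            (+-identityʳ 0#)

  Σ-++ : ∀ {a} {A : Set a} (f : A → Carrier) xs ys →
         Σ R (map f (xs ++ ys)) ≈ Σ R (map f xs) ⊕ Σ R (map f ys)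
  Σ-++ f []       ys = ≈-sym (+-identityˡ _)
  Σ-++ f (x ∷ xs) ys = ≈-trans (+-congˡ (Σ-++ f xs ys)) (≈-sym (+-assoc _ _ _))

  Σ-∷ʳ : ∀ {a} {A : Set a} (f : A → Carrier) xs y → Σ R (map f (xs ∷ʳ y)) ≈ Σ R (map f xs) ⊕ f y
  Σ-∷ʳ f xs y = ≈-trans (Σ-++ f xs (y ∷ [])) (+-congˡ (+-identityʳ (f y)))

  Σ-cong : ∀ {a} {A : Set a} {f g : A → Carrier} {xs} → All (λ x → f x ≈ g x) xs →
           Σ R (map f xs) ≈ Σ R (map g xs)
  Σ-cong []       = ≈-refl
  Σ-cong (p ∷ ps) = +-cong p (Σ-cong ps)

  Σ-zero : ∀ {a} {A : Set a} {f : A → Carrier} {xs} → All (λ x → f x ≈ 0#) xs → Σ R (map f xs) ≈ 0#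
  Σ-zero []       = ≈-refl
  Σ-zero (p ∷ ps) = ≈-trans (+-cong p (Σ-zero ps)) (+-identityʳ 0#)

  Σ-+ : ∀ {a} {A : Set a} (f g : A → Carrier) xs →
        Σ R (map (λ x → f x ⊕ g x) xs) ≈ Σ R (map f xs) ⊕ Σ R (map g xs)
  Σ-+ f g []       = ≈-sym (+-identityʳ 0#)
  Σ-+ f g (x ∷ xs) = ≈-trans (+-congˡ (Σ-+ f g xs)) (interchange (f x) (g x) _ _)

  Σ-telescope-fromLen : ∀ (f g G : ℤ → Carrier) a n →
    All (λ i → f i ⊕ G i ≈ g i ⊕ G (i + 1ℤ)) (fromLen a n) →
    Σ R (map f (fromLen a n)) ⊕ G a ≈ Σ R (map g (fromLen a n)) ⊕ G (a + + n)
  Σ-telescope-fromLen f g G a zero    []       = +-congˡ (≈-reflexive (cong G (sym (ℤP.+-identityʳ a))))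
  Σ-telescope-fromLen f g G a (suc n) (p ∷ ps) = begin
    (f a ⊕ Sf) ⊕ G a                  ≈⟨ xy∙z≈xz∙y (f a) Sf (G a) ⟩
    (f a ⊕ G a) ⊕ Sf                  ≈⟨ +-congʳ p ⟩
    (g a ⊕ G (a + 1ℤ)) ⊕ Sf           ≈⟨ xy∙z≈x∙zy (g a) (G (a + 1ℤ)) Sf ⟩
    g a ⊕ (Sf ⊕ G (a + 1ℤ))           ≈⟨ +-congˡ (Σ-telescope-fromLen f g G (a + 1ℤ) n ps) ⟩
    g a ⊕ (Sg ⊕ G ((a + 1ℤ) + + n))   ≈⟨ ≈-sym (+-assoc _ _ _) ⟩
    (g a ⊕ Sg) ⊕ G ((a + 1ℤ) + + n)   ≡⟨ cong (λ b → (g a ⊕ Sg) ⊕ G b) (ℤP.+-assoc a 1ℤ (+ n)) ⟩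
    (g a ⊕ Sg) ⊕ G (a + + suc n)      ∎
    where
    Sf = Σ R (map f (fromLen (a + 1ℤ) n))
    Sg = Σ R (map g (fromLen (a + 1ℤ) n))

  Σ-telescope : ∀ (f g G : ℤ → Carrier) {a} b → a ≤ b + 1ℤ →
    All (λ i → f i ⊕ G i ≈ g i ⊕ G (i + 1ℤ)) (interval a b) →
    Σ R (map f (interval a b)) ⊕ G a ≈ Σ R (map g (interval a b)) ⊕ G (b + 1ℤ)
  Σ-telescope f g G {a} b a≤b+1 steps with i≤j⇒∃[n]j≡i+n a≤b+1
  ... | n , b+1≡a+n = begin
    Σ R (map f (interval a b)) ⊕ G a         ≡⟨ cong (λ is → Σ R (map f is) ⊕ G a) interval≡fromLen ⟩
    Σ R (map f (fromLen a n)) ⊕ G a          ≈⟨ Σ-telescope-fromLen f g G a n (subst (All _) interval≡fromLen steps) ⟩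
    Σ R (map g (fromLen a n)) ⊕ G (a + + n)  ≡⟨ cong₂ (λ is c → Σ R (map g is) ⊕ G c) (sym interval≡fromLen) (sym b+1≡a+n) ⟩
    Σ R (map g (interval a b)) ⊕ G (b + 1ℤ)  ∎
    where
    interval≡fromLen : interval a b ≡ fromLen a n
    interval≡fromLen = interval-fromLen b b+1≡a+n

  mixed-terms-cancel : ∀ A a B C D → (A ⊕ a ⊛ B) ⊛ C ⊕ (D ⊕ ⊝ a ⊛ C) ⊛ B ≈ B ⊛ D ⊕ C ⊛ A
  mixed-terms-cancel A a B C D = begin
    (A ⊕ a ⊛ B) ⊛ C ⊕ (D ⊕ ⊝ a ⊛ C) ⊛ B    ≈⟨ +-congˡ (*-congʳ (+-congˡ (≈-sym (-‿distribˡ-* a C)))) ⟩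
    (A ⊕ a ⊛ B) ⊛ C ⊕ (D ⊕ N) ⊛ B          ≈⟨ expand A a B C D N ⟩
    (B ⊛ D ⊕ C ⊛ A) ⊕ (N ⊕ a ⊛ C) ⊛ B      ≈⟨ +-congˡ (≈-trans (*-congʳ (-‿inverseˡ (a ⊛ C))) (zeroˡ B)) ⟩
    (B ⊛ D ⊕ C ⊛ A) ⊕ 0#                   ≈⟨ +-identityʳ _ ⟩
    B ⊛ D ⊕ C ⊛ A                          ∎
    where
    N = ⊝ (a ⊛ C)
    expand : ∀ A a B C D N → (A ⊕ a ⊛ B) ⊛ C ⊕ (D ⊕ N) ⊛ B ≈ (B ⊛ D ⊕ C ⊛ A) ⊕ (N ⊕ a ⊛ C) ⊛ B
    expand = solve 6 (λ A a B C D N → (A :+ a :* B) :* C :+ (D :+ N) :* B := (B :* D :+ C :* A) :+ (N :+ a :* C) :* B) ≈-refl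

  δ-≡ : ∀ {x y} → x ≡ y → δ R x y ≡ 1#
  δ-≡ {x} {y} x≡y with x Data.Integer.≟ y
  ... | yes _   = refl
  ... | no x≢y = ⊥-elim (x≢y x≡y)

  δ-≢ : ∀ {x y} → x ≢ y → δ R x y ≡ 0#
  δ-≢ {x} {y} x≢y with x Data.Integer.≟ y
  ... | yes x≡y = ⊥-elim (x≢y x≡y)
  ... | no _    = refl

  δ-suc : ∀ m n → δ R (+ suc m) (+ suc n) ≡ δ R (+ m) (+ n)
  δ-suc m n = by-cases (m ℕ.≟ n)
    where
    by-cases : Dec (m ≡ n) → δ R (+ suc m) (+ suc n) ≡ δ R (+ m) (+ n)
    by-cases (yes m≡n) = trans (δ-≡ (cong (+_ ∘ suc) m≡n)) (sym (δ-≡ (cong +_ m≡n)))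
    by-cases (no m≢n)  = trans (δ-≢ (m≢n ∘ ℕP.suc-injective ∘ ℤP.+-injective)) (sym (δ-≢ (m≢n ∘ ℤP.+-injective)))

  module _ (α : ℤ → Carrier) where

    H : ℤ → ℤ → ℤ → Carrier
    H l i j = h R ((i - j) + l) (vars R α i j)

    E : ℤ → ℤ → ℤ → Carrier
    E k i j = e R ((j - i) - k) (negVars R α (i + 1ℤ) (j - 1ℤ))

    H-∷ : ∀ l {i j} → i ≤ j → H l i j ≈ H (l - 1ℤ) (i + 1ℤ) j ⊕ α i ⊛ H (l - 1ℤ) i j
    H-∷ l {i} {j} i≤j = begin
      h R r (vars R α i j)                        ≡⟨ cong (h R r) vars-∷ ⟩
      h R r (α i ∷ xs)                            ≈⟨ h-∷ r (α i) xs ⟩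
      h R r xs ⊕ α i ⊛ h R (r - 1ℤ) (α i ∷ xs)    ≡⟨ cong₂ (λ s t → h R s xs ⊕ α i ⊛ t)
                                                            ([i-j]+l≡[[i+1]-j]+[l-1] i j l)
                                                            (cong₂ (h R) ([[i-j]+l]-1≡[i-j]+[l-1] i j l) (sym vars-∷)) ⟩
      H (l - 1ℤ) (i + 1ℤ) j ⊕ α i ⊛ H (l - 1ℤ) i j ∎
      where
      r = (i - j) + l
      xs = vars R α (i + 1ℤ) j
      vars-∷ : vars R α i j ≡ α i ∷ xs
      vars-∷ = cong (map α) (interval-∷ i≤j)
      [i-j]+l≡[[i+1]-j]+[l-1] : ∀ i j l → (i - j) + l ≡ ((i + 1ℤ) - j) + (l - 1ℤ)
      [i-j]+l≡[[i+1]-j]+[l-1] = solve-∀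

    H-∷ʳ : ∀ l {i j} → i ≤ j → H l i j ≈ H (l - 1ℤ) i (j - 1ℤ) ⊕ α j ⊛ H (l - 1ℤ) i j
    H-∷ʳ l {i} {j} i≤j = begin
      h R r (vars R α i j)                          ≡⟨ cong (h R r) vars-∷ʳ ⟩
      h R r (xs ∷ʳ α j)                             ≈⟨ h-∷ʳ r xs (α j) ⟩
      h R r xs ⊕ α j ⊛ h R (r - 1ℤ) (xs ∷ʳ α j)     ≡⟨ cong₂ (λ s t → h R s xs ⊕ α j ⊛ t)
                                                              ([i-j]+l≡[i-[j-1]]+[l-1] i j l)
                                                              (cong₂ (h R) ([[i-j]+l]-1≡[i-j]+[l-1] i j l) (sym vars-∷ʳ)) ⟩
      H (l - 1ℤ) i (j - 1ℤ) ⊕ α j ⊛ H (l - 1ℤ) i j  ∎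
      where
      r = (i - j) + l
      xs = vars R α i (j - 1ℤ)
      vars-∷ʳ : vars R α i j ≡ xs ∷ʳ α j
      vars-∷ʳ = trans (cong (map α) (interval-∷ʳ i≤j)) (map-++ α (interval i (j - 1ℤ)) (j ∷ []))
      [i-j]+l≡[i-[j-1]]+[l-1] : ∀ i j l → (i - j) + l ≡ (i - (j - 1ℤ)) + (l - 1ℤ)
      [i-j]+l≡[i-[j-1]]+[l-1] = solve-∀

    E-∷ : ∀ k {i j} → i + 1ℤ ≤ j → E k (i - 1ℤ) j ≈ E (k - 1ℤ) i j ⊕ ⊝ α i ⊛ E k i j
    E-∷ k {i} {j} i+1≤j = begin
      e R s (negVars R α ((i - 1ℤ) + 1ℤ) (j - 1ℤ))  ≡⟨ cong (e R s) negVars-∷ ⟩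
      e R s (⊝ α i ∷ xs)                            ≈⟨ e-∷ s (⊝ α i) xs ⟩
      e R s xs ⊕ ⊝ α i ⊛ e R (s - 1ℤ) xs            ≡⟨ cong₂ (λ s t → e R s xs ⊕ ⊝ α i ⊛ e R t xs)
                                                              ([j-[i-1]]-k≡[j-i]-[k-1] i j k) ([[j-[i-1]]-k]-1≡[j-i]-k i j k) ⟩
      E (k - 1ℤ) i j ⊕ ⊝ α i ⊛ E k i j              ∎
      where
      s = (j - (i - 1ℤ)) - k
      xs = negVars R α (i + 1ℤ) (j - 1ℤ)
      [j-[i-1]]-k≡[j-i]-[k-1] : ∀ i j k → (j - (i - 1ℤ)) - k ≡ (j - i) - (k - 1ℤ)
      [j-[i-1]]-k≡[j-i]-[k-1] = solve-∀
      [[j-[i-1]]-k]-1≡[j-i]-k : ∀ i j k → ((j - (i - 1ℤ)) - k) - 1ℤ ≡ (j - i) - k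
      [[j-[i-1]]-k]-1≡[j-i]-k = solve-∀
      [i-1]+1≡i : ∀ i → (i - 1ℤ) + 1ℤ ≡ i
      [i-1]+1≡i = solve-∀
      i≤j-1 : i ≤ j - 1ℤ
      i≤j-1 = subst₂ _≤_ ([a+1]-1≡a i) refl (ℤP.+-monoˡ-≤ (- 1ℤ) i+1≤j)
      negVars-∷ : negVars R α ((i - 1ℤ) + 1ℤ) (j - 1ℤ) ≡ ⊝ α i ∷ xs
      negVars-∷ = trans (cong (λ a → negVars R α a (j - 1ℤ)) ([i-1]+1≡i i))
                        (cong (map (⊝_ ∘ α)) (interval-∷ i≤j-1))

    E-∷ʳ : ∀ k {i j} → i + 1ℤ ≤ j → E k i (j + 1ℤ) ≈ E (k - 1ℤ) i j ⊕ ⊝ α j ⊛ E k i j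
    E-∷ʳ k {i} {j} i+1≤j = begin
      e R s (negVars R α (i + 1ℤ) ((j + 1ℤ) - 1ℤ))  ≡⟨ cong (e R s) negVars-∷ʳ ⟩
      e R s (xs ∷ʳ ⊝ α j)                           ≈⟨ e-∷ʳ s xs (⊝ α j) ⟩
      e R s xs ⊕ ⊝ α j ⊛ e R (s - 1ℤ) xs            ≡⟨ cong₂ (λ s t → e R s xs ⊕ ⊝ α j ⊛ e R t xs)
                                                              ([[j+1]-i]-k≡[j-i]-[k-1] i j k) ([[[j+1]-i]-k]-1≡[j-i]-k i j k) ⟩
      E (k - 1ℤ) i j ⊕ ⊝ α j ⊛ E k i j              ∎
      where
      s = ((j + 1ℤ) - i) - k
      xs = negVars R α (i + 1ℤ) (j - 1ℤ)
      [[j+1]-i]-k≡[j-i]-[k-1] : ∀ i j k → ((j + 1ℤ) - i) - k ≡ (j - i) - (k - 1ℤ)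
      [[j+1]-i]-k≡[j-i]-[k-1] = solve-∀
      [[[j+1]-i]-k]-1≡[j-i]-k : ∀ i j k → (((j + 1ℤ) - i) - k) - 1ℤ ≡ (j - i) - k
      [[[j+1]-i]-k]-1≡[j-i]-k = solve-∀
      negVars-∷ʳ : negVars R α (i + 1ℤ) ((j + 1ℤ) - 1ℤ) ≡ xs ∷ʳ ⊝ α j
      negVars-∷ʳ = trans (cong (negVars R α (i + 1ℤ)) ([a+1]-1≡a j))
                         (trans (cong (map (⊝_ ∘ α)) (interval-∷ʳ i+1≤j))
                                (map-++ (⊝_ ∘ α) (interval (i + 1ℤ) (j - 1ℤ)) (j ∷ [])))

    H-vanishes : ∀ l i j → (i - j) + l ≡ - 1ℤ → H l i j ≈ 0#
    H-vanishes l i j degree≡-1 = h-negative (vars R α i j) (subst (_< 0ℤ) (sym degree≡-1) -<+)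

    E₀-vanishes : ∀ {i j} → i + 1ℤ ≤ j → E 0ℤ i j ≈ 0#
    E₀-vanishes {i} i+1≤j with i≤j⇒∃[n]j≡i+n i+1≤j
    ... | n , refl = begin
      e R ((j - i) - 0ℤ) (map (⊝_ ∘ α) (interval (i + 1ℤ) (j - 1ℤ)))
          ≡⟨ cong₂ (λ r is → e R r (map (⊝_ ∘ α) is)) ([j-i]-0≡1+n i (+ n))
                   (interval-fromLen (j - 1ℤ) ([[a+n]-1]+1≡a+n (i + 1ℤ) (+ n))) ⟩
      eₙ R (suc n) (map (⊝_ ∘ α) (fromLen (i + 1ℤ) n))
          ≈⟨ eₙ-vanishes (map (⊝_ ∘ α) (fromLen (i + 1ℤ) n))
                         (s≤s (ℕP.≤-reflexive (trans (length-map _ (fromLen (i + 1ℤ) n)) (length-fromLen _ n)))) ⟩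
      0# ∎
      where
      j = (i + 1ℤ) + + n
      [j-i]-0≡1+n : ∀ i n → (((i + 1ℤ) + n) - i) - 0ℤ ≡ 1ℤ + n
      [j-i]-0≡1+n = solve-∀

    column : ℤ → ℤ → ℤ → Carrier
    column k l j = Σ R (map (λ i → H l i j ⊛ E k i j) (interval (j - l) 0ℤ))

    total : ℤ → ℤ → Carrier
    total k l = Σ R (map (column k l) (interval 1ℤ l))

    boundaryTerm : ℤ → ℤ → ℤ → Carrier
    boundaryTerm k l j = H (l - 1ℤ) 1ℤ j ⊛ E k 0ℤ j

    boundary : ℤ → ℤ → Carrier
    boundary k l = Σ R (map (boundaryTerm k l) (interval 1ℤ l))

    column-truncation : ∀ {k l j} → k ≤ l → j ≤ l →
      Σ R (map (λ i → H l i j ⊛ E k i j) (interval (j - l) (0ℤ ⊓ (j - k)))) ≈ column k l j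
    column-truncation {k} {l} {j} k≤l j≤l = ≈-sym (begin
      column k l j                                              ≡⟨ cong (Σ R ∘ map F) (interval-++ a≤m+1 m≤0) ⟩
      Σ R (map F (interval a m ++ interval (m + 1ℤ) 0ℤ))        ≈⟨ Σ-++ F (interval a m) (interval (m + 1ℤ) 0ℤ) ⟩
      Σ R (map F (interval a m)) ⊕ Σ R (map F (interval (m + 1ℤ) 0ℤ))
                                                                ≈⟨ +-congˡ (Σ-zero (All-interval F-vanishes)) ⟩
      Σ R (map F (interval a m)) ⊕ 0#                           ≈⟨ +-identityʳ _ ⟩
      Σ R (map F (interval a m))                                ∎)
      where
      a = j - l
      m = 0ℤ ⊓ (j - k)
      F = λ i → H l i j ⊛ E k i j
      m≤0 : m ≤ 0ℤ
      m≤0 = ℤP.i⊓j≤i 0ℤ (j - k)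
      a≤m+1 : a ≤ m + 1ℤ
      a≤m+1 = ℤP.≤-trans (ℤP.⊓-glb (ℤP.i≤j⇒i-j≤0 j≤l) (ℤP.+-monoʳ-≤ j (ℤP.neg-mono-≤ k≤l))) (ℤP.i≤i+j m 1ℤ)
      [j-k]-i≡[j-i]-k : ∀ i j k → (j - k) - i ≡ (j - i) - k
      [j-k]-i≡[j-i]-k = solve-∀
      F-vanishes : ∀ {i} → m + 1ℤ ≤ i → i ≤ 0ℤ → F i ≈ 0#
      F-vanishes {i} m+1≤i i≤0 with i ℤP.≤? (j - k)
      ... | yes i≤j-k = ⊥-elim (ℤP.<-irrefl refl (ℤP.<-≤-trans m<i (ℤP.⊓-glb i≤0 i≤j-k)))
        where
        m<i : m < i
        m<i = ℤP.suc[i]≤j⇒i<j (subst (_≤ i) (ℤP.+-comm m 1ℤ) m+1≤i)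
      ... | no i≰j-k = ≈-trans (*-congˡ (e-negative _ degree<0)) (zeroʳ _)
        where
        degree<0 : (j - i) - k < 0ℤ
        degree<0 = subst₂ _<_ ([j-k]-i≡[j-i]-k i j k) (ℤP.+-inverseʳ i) (ℤP.+-monoˡ-< (- i) (ℤP.≰⇒> i≰j-k))

    sum≈total : ∀ {k l} → k ≤ l →
      Σ R (map (λ j → Σ R (map (λ i → H l i j ⊛ E k i j) (interval (j - l) (0ℤ ⊓ (j - k))))) (interval 1ℤ l))
        ≈ total k l
    sum≈total {k} {l} k≤l = Σ-cong (All-interval (λ {j} (_ : 1ℤ ≤ j) → column-truncation {j = j} k≤l))

    column-step : ∀ k l {j} → 1ℤ ≤ j → j ≤ l →
      column k l j ≈ column (k - 1ℤ) (l - 1ℤ) j ⊕ boundaryTerm k l j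
    column-step k l {j} 1≤j j≤l = begin
      column k l j
        ≈⟨ ≈-sym (+-identityʳ _) ⟩
      column k l j ⊕ 0#
        ≈⟨ +-congˡ (≈-sym (≈-trans (*-congˡ H[a]≈0) (zeroʳ _))) ⟩
      column k l j ⊕ G a
        ≈⟨ Σ-telescope f g G 0ℤ (ℤP.≤-trans a≤0 (ℤP.i≤i+j 0ℤ 1ℤ)) (All-interval step) ⟩
      Σ R (map g (interval a 0ℤ)) ⊕ G 1ℤ
        ≡⟨ cong (λ is → Σ R (map g is) ⊕ G 1ℤ) (interval-∷ a≤0) ⟩
      (g a ⊕ Σ R (map g (interval (a + 1ℤ) 0ℤ))) ⊕ G 1ℤ
        ≈⟨ +-cong (≈-trans (+-congʳ (≈-trans (*-congʳ H[a]≈0) (zeroˡ _))) (+-identityˡ _)) (*-comm _ _) ⟩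
      Σ R (map g (interval (a + 1ℤ) 0ℤ)) ⊕ boundaryTerm k l j
        ≡⟨ cong (λ b → Σ R (map g (interval b 0ℤ)) ⊕ boundaryTerm k l j) ([j-l]+1≡j-[l-1] j l) ⟩
      column (k - 1ℤ) (l - 1ℤ) j ⊕ boundaryTerm k l j ∎
      where
      a = j - l
      f g G : ℤ → Carrier
      f i = H l i j ⊛ E k i j
      g i = H (l - 1ℤ) i j ⊛ E (k - 1ℤ) i j
      G i = E k (i - 1ℤ) j ⊛ H (l - 1ℤ) i j
      a≤0 : a ≤ 0ℤ
      a≤0 = ℤP.i≤j⇒i-j≤0 j≤l
      [[j-l]-j]+[l-1]≡-1 : ∀ j l → ((j - l) - j) + (l - 1ℤ) ≡ - 1ℤ
      [[j-l]-j]+[l-1]≡-1 = solve-∀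
      [j-l]+1≡j-[l-1] : ∀ j l → (j - l) + 1ℤ ≡ j - (l - 1ℤ)
      [j-l]+1≡j-[l-1] = solve-∀
      H[a]≈0 : H (l - 1ℤ) a j ≈ 0#
      H[a]≈0 = H-vanishes (l - 1ℤ) a j ([[j-l]-j]+[l-1]≡-1 j l)
      step : ∀ {i} → a ≤ i → i ≤ 0ℤ → f i ⊕ G i ≈ g i ⊕ G (i + 1ℤ)
      step {i} _ i≤0 = begin
        H l i j ⊛ E k i j ⊕ E k (i - 1ℤ) j ⊛ H (l - 1ℤ) i j
          ≈⟨ +-cong (*-congʳ (H-∷ l i≤j)) (*-congʳ (E-∷ k i+1≤j)) ⟩
        (H (l - 1ℤ) (i + 1ℤ) j ⊕ α i ⊛ H (l - 1ℤ) i j) ⊛ E k i j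
          ⊕ (E (k - 1ℤ) i j ⊕ ⊝ α i ⊛ E k i j) ⊛ H (l - 1ℤ) i j
          ≈⟨ mixed-terms-cancel _ _ _ _ _ ⟩
        H (l - 1ℤ) i j ⊛ E (k - 1ℤ) i j ⊕ E k i j ⊛ H (l - 1ℤ) (i + 1ℤ) j
          ≡⟨ cong (λ b → g i ⊕ E k b j ⊛ H (l - 1ℤ) (i + 1ℤ) j) (sym ([a+1]-1≡a i)) ⟩
        g i ⊕ G (i + 1ℤ) ∎
        where
        i+1≤j : i + 1ℤ ≤ j
        i+1≤j = i≤0⇒i+1≤j i≤0 1≤j
        i≤j : i ≤ j
        i≤j = ℤP.≤-trans (ℤP.i≤i+j i 1ℤ) i+1≤j

    total-step : ∀ k l → 1ℤ ≤ l → total k l ≈ total (k - 1ℤ) (l - 1ℤ) ⊕ boundary k l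
    total-step k l 1≤l = begin
      total k l
        ≈⟨ Σ-cong (All-interval (column-step k l)) ⟩
      Σ R (map (λ j → column′ j ⊕ boundaryTerm k l j) (interval 1ℤ l))
        ≈⟨ Σ-+ column′ (boundaryTerm k l) (interval 1ℤ l) ⟩
      Σ R (map column′ (interval 1ℤ l)) ⊕ boundary k l
        ≡⟨ cong (λ is → Σ R (map column′ is) ⊕ boundary k l) (interval-∷ʳ 1≤l) ⟩
      Σ R (map column′ (interval 1ℤ (l - 1ℤ) ∷ʳ l)) ⊕ boundary k l
        ≈⟨ +-congʳ (Σ-∷ʳ column′ (interval 1ℤ (l - 1ℤ)) l) ⟩
      (total (k - 1ℤ) (l - 1ℤ) ⊕ column′ l) ⊕ boundary k l
        ≈⟨ +-congʳ (≈-trans (+-congˡ column′[l]≈0) (+-identityʳ _)) ⟩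
      total (k - 1ℤ) (l - 1ℤ) ⊕ boundary k l ∎
      where
      column′ = column (k - 1ℤ) (l - 1ℤ)
      0+1≡l-[l-1] : ∀ l → 0ℤ + 1ℤ ≡ l - (l - 1ℤ)
      0+1≡l-[l-1] = solve-∀
      column′[l]≈0 : column′ l ≈ 0#
      column′[l]≈0 = ≈-reflexive (cong (Σ R ∘ map _) (interval-empty 0ℤ (0+1≡l-[l-1] l)))

    boundary-step : ∀ k l → 1ℤ ≤ l →
      boundary k l ≈ boundary (k - 1ℤ) (l - 1ℤ) ⊕ e R (1ℤ - k) [] ⊛ h R (l - 1ℤ) []
    boundary-step k l 1≤l = ≈-sym (begin
      boundary (k - 1ℤ) (l - 1ℤ) ⊕ e R (1ℤ - k) [] ⊛ h R (l - 1ℤ) []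
        ≡⟨ cong (_⊕_ (boundary (k - 1ℤ) (l - 1ℤ))) (sym G[1]≡corner) ⟩
      boundary (k - 1ℤ) (l - 1ℤ) ⊕ G 1ℤ
        ≈⟨ +-congʳ (≈-sym (+-identityʳ _)) ⟩
      boundary (k - 1ℤ) (l - 1ℤ) ⊕ 0# ⊕ G 1ℤ
        ≈⟨ +-congʳ (≈-sym (≈-trans (Σ-∷ʳ f (interval 1ℤ (l - 1ℤ)) l) (+-congˡ f[l]≈0))) ⟩
      Σ R (map f (interval 1ℤ (l - 1ℤ) ∷ʳ l)) ⊕ G 1ℤ
        ≡⟨ cong (λ is → Σ R (map f is) ⊕ G 1ℤ) (sym (interval-∷ʳ 1≤l)) ⟩
      Σ R (map f (interval 1ℤ l)) ⊕ G 1ℤ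
        ≈⟨ Σ-telescope f (boundaryTerm k l) G l (ℤP.≤-trans 1≤l (ℤP.i≤i+j l 1ℤ)) (All-interval step) ⟩
      boundary k l ⊕ G (l + 1ℤ)
        ≈⟨ +-congˡ G[l+1]≈0 ⟩
      boundary k l ⊕ 0#
        ≈⟨ +-identityʳ _ ⟩
      boundary k l ∎)
      where
      f G : ℤ → Carrier
      f = boundaryTerm (k - 1ℤ) (l - 1ℤ)
      G j = E k 0ℤ j ⊛ H ((l - 1ℤ) - 1ℤ) 1ℤ (j - 1ℤ)
      [1-l]+[[l-1]-1]≡-1 : ∀ l → (1ℤ - l) + ((l - 1ℤ) - 1ℤ) ≡ - 1ℤ
      [1-l]+[[l-1]-1]≡-1 = solve-∀
      H[l]≈0 : H ((l - 1ℤ) - 1ℤ) 1ℤ l ≈ 0#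
      H[l]≈0 = H-vanishes ((l - 1ℤ) - 1ℤ) 1ℤ l ([1-l]+[[l-1]-1]≡-1 l)
      f[l]≈0 : f l ≈ 0#
      f[l]≈0 = ≈-trans (*-congʳ H[l]≈0) (zeroˡ _)
      G[l+1]≈0 : G (l + 1ℤ) ≈ 0#
      G[l+1]≈0 = ≈-trans (*-congˡ (≈-trans (≈-reflexive (cong (H ((l - 1ℤ) - 1ℤ) 1ℤ) ([a+1]-1≡a l))) H[l]≈0)) (zeroʳ _)
      [1-0]-k≡1-k : ∀ k → (1ℤ - 0ℤ) - k ≡ 1ℤ - k
      [1-0]-k≡1-k = solve-∀
      [1-0]+[[l-1]-1]≡l-1 : ∀ l → (1ℤ - 0ℤ) + ((l - 1ℤ) - 1ℤ) ≡ l - 1ℤ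
      [1-0]+[[l-1]-1]≡l-1 = solve-∀
      G[1]≡corner : G 1ℤ ≡ e R (1ℤ - k) [] ⊛ h R (l - 1ℤ) []
      G[1]≡corner = cong₂ (λ r s → e R r [] ⊛ h R s []) ([1-0]-k≡1-k k) ([1-0]+[[l-1]-1]≡l-1 l)
      step : ∀ {j} → 1ℤ ≤ j → j ≤ l → f j ⊕ G j ≈ boundaryTerm k l j ⊕ G (j + 1ℤ)
      step {j} 1≤j _ = ≈-sym (begin
        H (l - 1ℤ) 1ℤ j ⊛ E k 0ℤ j ⊕ E k 0ℤ (j + 1ℤ) ⊛ H ((l - 1ℤ) - 1ℤ) 1ℤ ((j + 1ℤ) - 1ℤ)
          ≡⟨ cong (λ b → boundaryTerm k l j ⊕ E k 0ℤ (j + 1ℤ) ⊛ H ((l - 1ℤ) - 1ℤ) 1ℤ b) ([a+1]-1≡a j) ⟩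
        H (l - 1ℤ) 1ℤ j ⊛ E k 0ℤ j ⊕ E k 0ℤ (j + 1ℤ) ⊛ H ((l - 1ℤ) - 1ℤ) 1ℤ j
          ≈⟨ +-cong (*-congʳ (H-∷ʳ (l - 1ℤ) 1≤j)) (*-congʳ (E-∷ʳ k {0ℤ} 1≤j)) ⟩
        (H ((l - 1ℤ) - 1ℤ) 1ℤ (j - 1ℤ) ⊕ α j ⊛ H ((l - 1ℤ) - 1ℤ) 1ℤ j) ⊛ E k 0ℤ j
          ⊕ (E (k - 1ℤ) 0ℤ j ⊕ ⊝ α j ⊛ E k 0ℤ j) ⊛ H ((l - 1ℤ) - 1ℤ) 1ℤ j
          ≈⟨ mixed-terms-cancel _ _ _ _ _ ⟩
        f j ⊕ G j ∎)

    total-0 : ∀ l → total 0ℤ l ≈ 0#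
    total-0 l = Σ-zero (All-interval column-vanishes)
      where
      column-vanishes : ∀ {j} → 1ℤ ≤ j → j ≤ l → column 0ℤ l j ≈ 0#
      column-vanishes {j} 1≤j _ = Σ-zero (All-interval term-vanishes)
        where
        term-vanishes : ∀ {i} → j - l ≤ i → i ≤ 0ℤ → H l i j ⊛ E 0ℤ i j ≈ 0#
        term-vanishes _ i≤0 = ≈-trans (*-congˡ (E₀-vanishes (i≤0⇒i+1≤j i≤0 1≤j))) (zeroʳ _)

    boundary-0 : ∀ l → boundary 0ℤ l ≈ 0#
    boundary-0 l = Σ-zero (All-interval boundaryTerm-vanishes)
      where
      boundaryTerm-vanishes : ∀ {j} → 1ℤ ≤ j → j ≤ l → boundaryTerm 0ℤ l j ≈ 0#
      boundaryTerm-vanishes 1≤j _ = ≈-trans (*-congˡ (E₀-vanishes {0ℤ} 1≤j)) (zeroʳ _)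

    boundary≈δ : ∀ K M → boundary (+ suc K) (+ suc K + + M) ≈ δ R (+ suc K) (+ suc K + + M)
    boundary≈δ zero    zero    = ≈-trans (boundary-step 1ℤ 1ℤ ℤP.≤-refl)
                                         (≈-trans (+-cong (boundary-0 0ℤ) (*-identityʳ 1#)) (+-identityˡ 1#))
    boundary≈δ zero    (suc M) = ≈-trans (boundary-step 1ℤ (+ suc (suc M)) (+≤+ (s≤s z≤n)))
                                         (≈-trans (+-cong (boundary-0 (+ suc M)) (zeroʳ 1#)) (+-identityˡ 0#))
    boundary≈δ (suc K) M       = begin
      boundary (+ suc (suc K)) (+ suc (suc K) + + M)
        ≈⟨ boundary-step (+ suc (suc K)) (+ suc (suc K) + + M) (+≤+ (s≤s z≤n)) ⟩
      boundary (+ suc K) (+ suc K + + M) ⊕ 0# ⊛ h R (+ (suc K ℕ.+ M)) []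
        ≈⟨ +-cong (boundary≈δ K M) (zeroˡ _) ⟩
      δ R (+ suc K) (+ suc K + + M) ⊕ 0#
        ≈⟨ +-identityʳ _ ⟩
      δ R (+ suc K) (+ suc K + + M)
        ≡⟨ sym (δ-suc (suc K) (suc K ℕ.+ M)) ⟩
      δ R (+ suc (suc K)) (+ suc (suc K) + + M) ∎

    total≈kδ : ∀ K M → total (+ K) (+ K + + M) ≈ natR R K ⊛ δ R (+ K) (+ K + + M)
    total≈kδ zero    M = ≈-trans (total-0 (+ M)) (≈-sym (zeroˡ _))
    total≈kδ (suc K) M = begin
      total (+ suc K) (+ suc K + + M)                              ≈⟨ total-step (+ suc K) (+ suc K + + M) (+≤+ (s≤s z≤n)) ⟩
      total (+ K) (+ K + + M) ⊕ boundary (+ suc K) (+ suc K + + M) ≈⟨ +-cong (total≈kδ K M) (boundary≈δ K M) ⟩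
      natR R K ⊛ δ R (+ K) (+ K + + M) ⊕ d                         ≡⟨ cong (λ x → natR R K ⊛ x ⊕ d) (sym (δ-suc K (K ℕ.+ M))) ⟩
      natR R K ⊛ d ⊕ d                                             ≈⟨ n*d+d≈[1+n]*d (natR R K) d ⟩
      (1# ⊕ natR R K) ⊛ d                                          ∎
      where
      d = δ R (+ suc K) (+ suc K + + M)
      n*d+d≈[1+n]*d : ∀ n d → n ⊛ d ⊕ d ≈ (1# ⊕ n) ⊛ d
      n*d+d≈[1+n]*d = solve 2 (λ n d → n :* d :+ d := (con 1 :+ n) :* d) ≈-refl

    total≈∣k∣δ : ∀ {k l} → 0ℤ ≤ k → k ≤ l → total k l ≈ natR R ∣ k ∣ ⊛ δ R k l
    total≈∣k∣δ {+ K} _ k≤l with i≤j⇒∃[n]j≡i+n k≤l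
    ... | M , refl = total≈kδ K M

proposition2p8 : ∀ {c ℓ'} (R : CommutativeRing c ℓ') (α : ℤ → CommutativeRing.Carrier R)
    (k l : ℤ) → 0ℤ < k → k ≤ l →
    CommutativeRing._≈_ R
      (Σ R (map (λ j → Σ R (map (λ i → CommutativeRing._*_ R (h R ((i - j) + l) (vars R α i j)) (e R ((j - i) - k) (negVars R α (i + 1ℤ) (j - 1ℤ)))) (interval (j - l) (0ℤ ⊓ (j - k))))) (interval 1ℤ l)))
      (CommutativeRing._*_ R (natR R ∣ k ∣) (δ R k l))
proposition2p8 R α k l 0<k k≤l =
  CommutativeRing.trans R (sum≈total R α k≤l) (total≈∣k∣δ R α (ℤP.<⇒≤ 0<k) k≤l)
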